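{- Let $n\ge 2$ and $(a_1,\ldots,a_{n-1})\in\mathcal{A}_{n-1}$. Then $(1,a_1,\ldots,a_{n-1})\in\mathcal{A}_n$ and $(a_1,\ldots,a_{n-1},1)\in\mathcal{A}_n$, and $$c_{(1,a_1,\ldots,a_{n-1})}=c_{(a_1,\ldots,a_{n-1},1)}=c_{(a_1,\ldots,a_{n-1})},$$ where the left-hand coefficients are taken in $p_n$ and the right-hand one in $p_{n-1}$. (That is, the coefficients of $p_{n}$ contain at least two copies of the coefficients of $p_{n-1}$.)
   Context: For $m\in\mathbb{N}$ and indeterminates $x_1,\ldots,x_m$, let $p_m=x_1(x_1+x_2)\cdots(x_1+x_2+\cdots+x_m)$. Let $\mathbb{N}_0=\mathbb{N}\cup\{0\}$ and $\mathcal{A}_m=\{(a_1,\ldots,a_m)\in\mathbb{N}_0^m : \sum_{i=k+1}^m a_i\le m-k \text{ for all } 1\le k\le m-1,\ \sum_{i=1}^m a_i=m\}$. For $(a_1,\ldots,a_m)\in\mathcal{A}_m$, $c_{(a_1,\ldots,a_m)}$ denotes the coefficient of $x_1^{a_1}\cdots x_m^{a_m}$ in the expansion of $p_m$ (after combining like terms). -}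

module Defs where

open import Data.Nat using (ℕ; zero; suc; _+_; _*_; _∸_; _≤_)
open import Data.Nat.Properties using () renaming (_≟_ to _≟ℕ_)
open import Data.Fin using (Fin; toℕ)
open import Data.Fin.Properties using () renaming (_≤?_ to _≤?ᶠ_)
open import Data.Product using (_×_; _,_)
open import Data.List as List using (List; []; _∷_; _++_; concatMap; map; foldr; filter; allFin)
open import Data.Vec as Vec using (Vec; replicate; zipWith; updateAt; toList)
open import Data.Vec.Properties using (≡-dec)
open import Relation.Nullary using (Dec; yes; no)
open import Relation.Binary.PropositionalEquality using (_≡_)
open import Data.Nat.ListAction using () renaming (sum to sumL)

-- Polynomials in m variables x_1..x_m (indexed by Fin m) with ℕ coefficients,
-- represented as (unreduced) lists of terms  (coefficient , exponent vector).
Monomial : ℕ → Set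
Monomial m = Vec ℕ m

Poly : ℕ → Set
Poly m = List (ℕ × Monomial m)

oneP : ∀ {m} → Poly m
oneP = (1 , replicate _ 0) ∷ []

varP : ∀ {m} → Fin m → Poly m
varP i = (1 , updateAt (replicate _ 0) i (λ _ → 1)) ∷ []

_+P_ : ∀ {m} → Poly m → Poly m → Poly m
p +P q = p ++ q

_*P_ : ∀ {m} → Poly m → Poly m → Poly m
p *P q = concatMap (λ { (c , e) → map (λ { (d , f) → (c * d , zipWith _+_ e f) }) q }) p

sumP : ∀ {m} → List (Poly m) → Poly m
sumP = foldr _+P_ []

prodP : ∀ {m} → List (Poly m) → Poly m
prodP = foldr _*P_ oneP

-- the linear form x_1 + ... + x_{k+1}  (k : Fin m, 0-based)
partialSum : ∀ {m} → Fin m → Poly m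
partialSum k = sumP (map varP (filter (λ i → i ≤?ᶠ k) (allFin _)))

p : (m : ℕ) → Poly m
p m = prodP (map partialSum (allFin m))

-- coefficient of the monomial x^a after combining like terms
coeff : ∀ {m} → Poly m → Monomial m → ℕ
coeff [] a = 0
coeff ((c , e) ∷ q) a with ≡-dec _≟ℕ_ e a
... | yes _ = c + coeff q a
... | no  _ = coeff q a

record InA (m : ℕ) (a : Vec ℕ m) : Set where
  field
    tails : (k : ℕ) → 1 ≤ k → k Data.Nat.< m →
            sumL (List.drop k (toList a)) ≤ m ∸ k
    total : Vec.sum a ≡ m

-- Write p_{m+1} = x₁ · ∏ₖ (x₁ + (x₂ + ⋯ + x_{k+1})): the factor x₁ already uses the
-- exponent 1 of x₁, so only the x₁-free part of the remaining product contributes, and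
-- that part is p_m in the variables x₂, …, x_{m+1}. Dually, p_{m+1} = p_m · (x₁ + ⋯ + x_{m+1})
-- with p_m free of x_{m+1}, so the exponent 1 of x_{m+1} must come from the term x_{m+1}
-- of the last factor.

module Submission where

open import Defs
open import Data.Nat using (ℕ; suc; _≤_)
open import Data.Vec using (Vec; _∷_; _∷ʳ_)
open import Data.Product using (_×_)
open import Relation.Binary.PropositionalEquality using (_≡_)

open import Data.Bool using (true; false)
open import Data.Fin using (Fin; inject₁; fromℕ; toℕ)
open import Data.Fin.Properties using (≤fromℕ; toℕ-inject₁; toℕ-fromℕ; toℕ<n) renaming (_≤?_ to _≤?ᶠ_)
open import Data.List as List using (List; []; _∷_; _++_; map; filter; allFin; tabulate)
open import Data.List.Properties
  using (drop-all; map-++; map-∘; map-tabulate; filter-++; filter-≐; filter-all; filter-none; filter-reject; ++-identityʳ)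
open import Data.List.Relation.Unary.All using (universal)
open import Data.Nat using (zero; _+_; _*_; _∸_; _<_; z≤n; s≤s; s≤s⁻¹)
open import Data.Nat.ListAction using () renaming (sum to sumL)
open import Data.Nat.Properties
open import Data.Product using (_,_)
open import Data.Sum using (inj₁; inj₂)
open import Data.Vec as Vec using (replicate; zipWith; updateAt; toList)
open import Data.Vec.Properties
  using (length-toList; ≡-dec; ∷-injectiveʳ; ∷ʳ-injectiveˡ; ∷ʳ-injectiveʳ; zipWith-assoc; zipWith-identityˡ; zipWith-identityʳ)
open import Function using (_∘_; id)
open import Function.Definitions using (Injective)
open import Relation.Binary.PropositionalEquality
  using (refl; sym; trans; cong; cong₂; subst₂; _≗_; _≢_; module ≡-Reasoning)
open import Relation.Nullary using (yes; no; ¬_; does; contradiction)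
open import Relation.Unary using (Decidable)

open ≡-Reasoning

infixl 6 _+ᵐ_

_+ᵐ_ : ∀ {m} → Monomial m → Monomial m → Monomial m
_+ᵐ_ = zipWith _+_

0ᵐ : ∀ {m} → Monomial m
0ᵐ = replicate _ 0

unit : ∀ {m} → Fin m → Monomial m
unit i = updateAt 0ᵐ i (λ _ → 1)

+ᵐ-assoc : ∀ {m} (e f g : Monomial m) → e +ᵐ f +ᵐ g ≡ e +ᵐ (f +ᵐ g)
+ᵐ-assoc = zipWith-assoc +-assoc

+ᵐ-identityˡ : ∀ {m} (e : Monomial m) → 0ᵐ +ᵐ e ≡ e
+ᵐ-identityˡ = zipWith-identityˡ +-identityˡ

+ᵐ-identityʳ : ∀ {m} (e : Monomial m) → e +ᵐ 0ᵐ ≡ e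
+ᵐ-identityʳ = zipWith-identityʳ +-identityʳ

+ᵐ-∷ʳ : ∀ {m} (e f : Monomial m) x y → (e ∷ʳ x) +ᵐ (f ∷ʳ y) ≡ (e +ᵐ f) ∷ʳ (x + y)
+ᵐ-∷ʳ Vec.[] Vec.[] x y = refl
+ᵐ-∷ʳ (u ∷ e) (v ∷ f) x y = cong (u + v ∷_) (+ᵐ-∷ʳ e f x y)

0ᵐ-∷ʳ : ∀ m → 0ᵐ {m} ∷ʳ 0 ≡ 0ᵐ
0ᵐ-∷ʳ zero = refl
0ᵐ-∷ʳ (suc m) = cong (0 ∷_) (0ᵐ-∷ʳ m)

unit-inject₁ : ∀ {m} (i : Fin m) → unit (inject₁ i) ≡ unit i ∷ʳ 0
unit-inject₁ {suc m} Fin.zero = cong (1 ∷_) (sym (0ᵐ-∷ʳ m))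
unit-inject₁ (Fin.suc i) = cong (0 ∷_) (unit-inject₁ i)

unit-fromℕ : ∀ m → unit (fromℕ m) ≡ 0ᵐ ∷ʳ 1
unit-fromℕ zero = refl
unit-fromℕ (suc m) = cong (0 ∷_) (unit-fromℕ m)

⟦_⟧ : ∀ {m} → Poly m → (Monomial m → ℕ) → ℕ
⟦ [] ⟧ g = 0
⟦ (c , e) ∷ q ⟧ g = c * g e + ⟦ q ⟧ g

⟦⟧-cong : ∀ {m} (q : Poly m) {g h : Monomial m → ℕ} → g ≗ h → ⟦ q ⟧ g ≡ ⟦ q ⟧ h
⟦⟧-cong [] g≗h = refl
⟦⟧-cong ((c , e) ∷ q) g≗h = cong₂ _+_ (cong (c *_) (g≗h e)) (⟦⟧-cong q g≗h)

⟦⟧-vanishing : ∀ {m} (q : Poly m) {g : Monomial m → ℕ} → (∀ e → g e ≡ 0) → ⟦ q ⟧ g ≡ 0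
⟦⟧-vanishing [] g≗0 = refl
⟦⟧-vanishing ((c , e) ∷ q) g≗0 rewrite g≗0 e | *-zeroʳ c = ⟦⟧-vanishing q g≗0

⟦⟧-++ : ∀ {m} (q r : Poly m) g → ⟦ q ++ r ⟧ g ≡ ⟦ q ⟧ g + ⟦ r ⟧ g
⟦⟧-++ [] r g = refl
⟦⟧-++ ((c , e) ∷ q) r g = trans (cong (c * g e +_) (⟦⟧-++ q r g)) (sym (+-assoc (c * g e) _ _))

⟦⟧-singleton : ∀ {m} (e : Monomial m) g → ⟦ (1 , e) ∷ [] ⟧ g ≡ g e
⟦⟧-singleton e g = trans (+-identityʳ _) (*-identityˡ _)

⟦⟧-oneP : ∀ {m} (g : Monomial m → ℕ) → ⟦ oneP ⟧ g ≡ g 0ᵐ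
⟦⟧-oneP = ⟦⟧-singleton 0ᵐ

-- The pattern lambda inside _*P_ cannot be named, so the row of products of one
-- term of q with all of r is referred to as a product with a singleton.
*P-∷ : ∀ {m} c (e : Monomial m) q r → ((c , e) ∷ q) *P r ≡ (((c , e) ∷ []) *P r) ++ (q *P r)
*P-∷ c e q r = cong (_++ q *P r) (sym (++-identityʳ _))

⟦⟧-term-*P : ∀ {m} c (e : Monomial m) r g →
             ⟦ ((c , e) ∷ []) *P r ⟧ g ≡ c * ⟦ r ⟧ (λ f → g (e +ᵐ f))
⟦⟧-term-*P c e [] g = sym (*-zeroʳ c)
⟦⟧-term-*P c e ((d , f) ∷ r) g = begin
  c * d * g (e +ᵐ f) + ⟦ ((c , e) ∷ []) *P r ⟧ g
    ≡⟨ cong₂ _+_ (*-assoc c d _) (⟦⟧-term-*P c e r g) ⟩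
  c * (d * g (e +ᵐ f)) + c * ⟦ r ⟧ (λ f → g (e +ᵐ f))
    ≡⟨ sym (*-distribˡ-+ c _ _) ⟩
  c * ⟦ (d , f) ∷ r ⟧ (λ f → g (e +ᵐ f)) ∎

⟦⟧-*P : ∀ {m} (q r : Poly m) g → ⟦ q *P r ⟧ g ≡ ⟦ q ⟧ (λ e → ⟦ r ⟧ (λ f → g (e +ᵐ f)))
⟦⟧-*P [] r g = refl
⟦⟧-*P ((c , e) ∷ q) r g = begin
  ⟦ ((c , e) ∷ q) *P r ⟧ g                   ≡⟨ cong (λ s → ⟦ s ⟧ g) (*P-∷ c e q r) ⟩
  ⟦ (((c , e) ∷ []) *P r) ++ (q *P r) ⟧ g    ≡⟨ ⟦⟧-++ (((c , e) ∷ []) *P r) (q *P r) g ⟩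
  ⟦ ((c , e) ∷ []) *P r ⟧ g + ⟦ q *P r ⟧ g   ≡⟨ cong₂ _+_ (⟦⟧-term-*P c e r g) (⟦⟧-*P q r g) ⟩
  c * ⟦ r ⟧ (λ f → g (e +ᵐ f)) + ⟦ q ⟧ (λ e → ⟦ r ⟧ (λ f → g (e +ᵐ f))) ∎

⟦⟧-*P-oneP : ∀ {m} (q : Poly m) g → ⟦ q *P oneP ⟧ g ≡ ⟦ q ⟧ g
⟦⟧-*P-oneP q g = trans (⟦⟧-*P q oneP g)
  (⟦⟧-cong q (λ e → trans (⟦⟧-oneP (λ f → g (e +ᵐ f))) (cong g (+ᵐ-identityʳ e))))

⟦⟧-prodP-++ : ∀ {m} (qs rs : List (Poly m)) g →
              ⟦ prodP (qs ++ rs) ⟧ g ≡ ⟦ prodP qs ⟧ (λ e → ⟦ prodP rs ⟧ (λ f → g (e +ᵐ f)))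
⟦⟧-prodP-++ [] rs g = begin
  ⟦ prodP rs ⟧ g                                        ≡⟨ ⟦⟧-cong (prodP rs) (cong g ∘ sym ∘ +ᵐ-identityˡ) ⟩
  ⟦ prodP rs ⟧ (λ f → g (0ᵐ +ᵐ f))                      ≡⟨ ⟦⟧-oneP (λ e → ⟦ prodP rs ⟧ (λ f → g (e +ᵐ f))) ⟨
  ⟦ oneP ⟧ (λ e → ⟦ prodP rs ⟧ (λ f → g (e +ᵐ f)))      ∎
⟦⟧-prodP-++ (q ∷ qs) rs g = begin
  ⟦ q *P prodP (qs ++ rs) ⟧ g
    ≡⟨ ⟦⟧-*P q (prodP (qs ++ rs)) g ⟩
  ⟦ q ⟧ (λ e → ⟦ prodP (qs ++ rs) ⟧ (λ f → g (e +ᵐ f)))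
    ≡⟨ ⟦⟧-cong q (λ e → trans (⟦⟧-prodP-++ qs rs _)
         (⟦⟧-cong (prodP qs) λ f → ⟦⟧-cong (prodP rs) λ h → cong g (sym (+ᵐ-assoc e f h)))) ⟩
  ⟦ q ⟧ (λ e → ⟦ prodP qs ⟧ (λ f → ⟦ prodP rs ⟧ (λ h → g (e +ᵐ f +ᵐ h))))
    ≡⟨ ⟦⟧-*P q (prodP qs) _ ⟨
  ⟦ q *P prodP qs ⟧ (λ e → ⟦ prodP rs ⟧ (λ f → g (e +ᵐ f))) ∎

⟦⟧-prodP-∷ʳ : ∀ {m} (qs : List (Poly m)) r g →
              ⟦ prodP (qs List.∷ʳ r) ⟧ g ≡ ⟦ prodP qs ⟧ (λ e → ⟦ r ⟧ (λ f → g (e +ᵐ f)))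
⟦⟧-prodP-∷ʳ qs r g = trans (⟦⟧-prodP-++ qs (r ∷ []) g) (⟦⟧-cong (prodP qs) λ e → ⟦⟧-*P-oneP r _)

δ : ∀ {m} → Monomial m → Monomial m → ℕ
δ a e with ≡-dec _≟_ e a
... | yes _ = 1
... | no  _ = 0

coeff≡⟦⟧δ : ∀ {m} (q : Poly m) a → coeff q a ≡ ⟦ q ⟧ (δ a)
coeff≡⟦⟧δ [] a = refl
coeff≡⟦⟧δ ((c , e) ∷ q) a with ≡-dec _≟_ e a
... | yes _ = cong₂ _+_ (sym (*-identityʳ c)) (coeff≡⟦⟧δ q a)
... | no  _ = trans (coeff≡⟦⟧δ q a) (cong (_+ ⟦ q ⟧ (δ a)) (sym (*-zeroʳ c)))

δ-≢ : ∀ {m} {a e : Monomial m} → e ≢ a → δ a e ≡ 0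
δ-≢ {a = a} {e} e≢a with ≡-dec _≟_ e a
... | yes e≡a = contradiction e≡a e≢a
... | no  _   = refl

δ-injective : ∀ {m n} (φ : Monomial m → Monomial n) → Injective _≡_ _≡_ φ →
              ∀ a e → δ (φ a) (φ e) ≡ δ a e
δ-injective φ φ-inj a e with ≡-dec _≟_ (φ e) (φ a) | ≡-dec _≟_ e a
... | yes _   | yes _   = refl
... | no  _   | no  _   = refl
... | yes φ≡  | no  e≢a = contradiction (φ-inj φ≡) e≢a
... | no  φ≢  | yes e≡a = contradiction (cong φ e≡a) φ≢

⟦⟧-prodP-hom : ∀ {I : Set} {m n} (φ : Monomial m → Monomial n) →
               φ 0ᵐ ≡ 0ᵐ → (∀ e f → φ (e +ᵐ f) ≡ φ e +ᵐ φ f) →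
               (F : I → Poly n) (G : I → Poly m) → (∀ i g → ⟦ F i ⟧ g ≡ ⟦ G i ⟧ (g ∘ φ)) →
               ∀ is g → ⟦ prodP (map F is) ⟧ g ≡ ⟦ prodP (map G is) ⟧ (g ∘ φ)
⟦⟧-prodP-hom φ φ-0 φ-+ F G F≈G [] g =
  trans (⟦⟧-oneP g) (sym (trans (⟦⟧-oneP (g ∘ φ)) (cong g φ-0)))
⟦⟧-prodP-hom φ φ-0 φ-+ F G F≈G (i ∷ is) g = begin
  ⟦ F i *P prodP (map F is) ⟧ g
    ≡⟨ ⟦⟧-*P (F i) _ g ⟩
  ⟦ F i ⟧ (λ e → ⟦ prodP (map F is) ⟧ (λ f → g (e +ᵐ f)))
    ≡⟨ F≈G i _ ⟩
  ⟦ G i ⟧ (λ e → ⟦ prodP (map F is) ⟧ (λ f → g (φ e +ᵐ f)))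
    ≡⟨ ⟦⟧-cong (G i) (λ e → trans (⟦⟧-prodP-hom φ φ-0 φ-+ F G F≈G is _)
                                  (⟦⟧-cong (prodP (map G is)) λ f → cong g (sym (φ-+ e f)))) ⟩
  ⟦ G i ⟧ (λ e → ⟦ prodP (map G is) ⟧ (λ f → g (φ (e +ᵐ f))))
    ≡⟨ ⟦⟧-*P (G i) _ (g ∘ φ) ⟨
  ⟦ G i *P prodP (map G is) ⟧ (g ∘ φ) ∎

atHeadZero : ∀ {m} → (Monomial m → ℕ) → Monomial (suc m) → ℕ
atHeadZero h (zero  ∷ e) = h e
atHeadZero h (suc _ ∷ _) = 0

⟦⟧-prodP-atHeadZero : ∀ {I : Set} {m} (F : I → Poly (suc m)) (G : I → Poly m) →
                      (∀ i g → ⟦ F i ⟧ g ≡ g (unit Fin.zero) + ⟦ G i ⟧ (g ∘ (0 ∷_))) →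
                      ∀ is h → ⟦ prodP (map F is) ⟧ (atHeadZero h) ≡ ⟦ prodP (map G is) ⟧ h
⟦⟧-prodP-atHeadZero F G F≈x₁+G [] h = refl
⟦⟧-prodP-atHeadZero F G F≈x₁+G (i ∷ is) h = begin
  ⟦ F i *P R ⟧ (atHeadZero h)
    ≡⟨ ⟦⟧-*P (F i) R (atHeadZero h) ⟩
  ⟦ F i ⟧ (λ e → ⟦ R ⟧ (λ f → atHeadZero h (e +ᵐ f)))
    ≡⟨ F≈x₁+G i _ ⟩
  ⟦ R ⟧ (λ f → atHeadZero h (unit Fin.zero +ᵐ f))
    + ⟦ G i ⟧ (λ e → ⟦ R ⟧ (λ f → atHeadZero h ((0 ∷ e) +ᵐ f)))
    ≡⟨ cong₂ _+_ (⟦⟧-vanishing R x₁-divides)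
                 (⟦⟧-cong (G i) λ e → trans (⟦⟧-cong R (shift e))
                                            (⟦⟧-prodP-atHeadZero F G F≈x₁+G is (λ f → h (e +ᵐ f)))) ⟩
  ⟦ G i ⟧ (λ e → ⟦ prodP (map G is) ⟧ (λ f → h (e +ᵐ f)))
    ≡⟨ ⟦⟧-*P (G i) _ h ⟨
  ⟦ G i *P prodP (map G is) ⟧ h ∎
  where
  R : Poly _
  R = prodP (map F is)
  x₁-divides : ∀ f → atHeadZero h (unit Fin.zero +ᵐ f) ≡ 0
  x₁-divides (_ ∷ _) = refl
  shift : ∀ e f → atHeadZero h ((0 ∷ e) +ᵐ f) ≡ atHeadZero (λ t → h (e +ᵐ t)) f
  shift e (zero  ∷ _) = refl
  shift e (suc _ ∷ _) = refl

filter-map : ∀ {A B : Set} {P : B → Set} (P? : Decidable P) (f : A → B) xs →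
             filter P? (map f xs) ≡ map f (filter (P? ∘ f) xs)
filter-map P? f [] = refl
filter-map P? f (x ∷ xs) with does (P? (f x))
... | true  = cong (f x ∷_) (filter-map P? f xs)
... | false = filter-map P? f xs

tabulate-∷ʳ : ∀ {A : Set} n (f : Fin (suc n) → A) →
              tabulate f ≡ tabulate (f ∘ inject₁) List.∷ʳ f (fromℕ n)
tabulate-∷ʳ zero    f = refl
tabulate-∷ʳ (suc n) f = cong (f Fin.zero ∷_) (tabulate-∷ʳ n (f ∘ Fin.suc))

allFin-suc : ∀ m → allFin (suc m) ≡ Fin.zero ∷ map Fin.suc (allFin m)
allFin-suc m = cong (Fin.zero ∷_) (sym (map-tabulate id Fin.suc))

allFin-∷ʳ : ∀ m → allFin (suc m) ≡ map inject₁ (allFin m) List.∷ʳ fromℕ m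
allFin-∷ʳ m = trans (tabulate-∷ʳ m id) (cong (List._∷ʳ fromℕ m) (sym (map-tabulate id inject₁)))

atMost : ∀ {m} → Fin m → List (Fin m)
atMost k = filter (_≤?ᶠ k) (allFin _)

atMost-zero : ∀ m → atMost {suc m} Fin.zero ≡ Fin.zero ∷ []
atMost-zero m = begin
  filter (_≤?ᶠ Fin.zero {m}) (allFin (suc m))
    ≡⟨ cong (filter (_≤?ᶠ Fin.zero {m})) (allFin-suc m) ⟩
  Fin.zero ∷ filter (_≤?ᶠ Fin.zero {m}) (map Fin.suc (allFin m))
    ≡⟨ cong (Fin.zero ∷_) (filter-map (_≤?ᶠ Fin.zero {m}) Fin.suc (allFin m)) ⟩
  Fin.zero ∷ map Fin.suc (filter (λ i → Fin.suc i ≤?ᶠ Fin.zero {m}) (allFin m))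
    ≡⟨ cong (λ is → Fin.zero ∷ map Fin.suc is) (filter-none _ (universal (λ _ ()) (allFin m))) ⟩
  Fin.zero ∷ [] ∎

atMost-suc : ∀ {m} (k : Fin m) → atMost (Fin.suc k) ≡ Fin.zero ∷ map Fin.suc (atMost k)
atMost-suc {m} k = begin
  filter (_≤?ᶠ Fin.suc k) (allFin (suc m))
    ≡⟨ cong (filter (_≤?ᶠ Fin.suc k)) (allFin-suc m) ⟩
  Fin.zero ∷ filter (_≤?ᶠ Fin.suc k) (map Fin.suc (allFin m))
    ≡⟨ cong (Fin.zero ∷_) (filter-map (_≤?ᶠ Fin.suc k) Fin.suc (allFin m)) ⟩
  Fin.zero ∷ map Fin.suc (filter (λ i → Fin.suc i ≤?ᶠ Fin.suc k) (allFin m))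
    ≡⟨ cong (λ is → Fin.zero ∷ map Fin.suc is) (filter-≐ _ (_≤?ᶠ k) (s≤s⁻¹ , s≤s) (allFin m)) ⟩
  Fin.zero ∷ map Fin.suc (atMost k) ∎

atMost-inject₁ : ∀ {m} (k : Fin m) → atMost (inject₁ k) ≡ map inject₁ (atMost k)
atMost-inject₁ {m} k = begin
  filter (_≤?ᶠ inject₁ k) (allFin (suc m))
    ≡⟨ cong (filter (_≤?ᶠ inject₁ k)) (allFin-∷ʳ m) ⟩
  filter (_≤?ᶠ inject₁ k) (map inject₁ (allFin m) ++ fromℕ m ∷ [])
    ≡⟨ filter-++ (_≤?ᶠ inject₁ k) (map inject₁ (allFin m)) _ ⟩
  filter (_≤?ᶠ inject₁ k) (map inject₁ (allFin m)) ++ filter (_≤?ᶠ inject₁ k) (fromℕ m ∷ [])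
    ≡⟨ cong₂ _++_ (filter-map (_≤?ᶠ inject₁ k) inject₁ (allFin m)) (filter-reject (_≤?ᶠ inject₁ k) fromℕ≰) ⟩
  map inject₁ (filter (λ i → inject₁ i ≤?ᶠ inject₁ k) (allFin m)) ++ []
    ≡⟨ ++-identityʳ _ ⟩
  map inject₁ (filter (λ i → inject₁ i ≤?ᶠ inject₁ k) (allFin m))
    ≡⟨ cong (map inject₁) (filter-≐ _ (_≤?ᶠ k) (inject₁-≤⇒≤ , ≤⇒inject₁-≤) (allFin m)) ⟩
  map inject₁ (atMost k) ∎
  where
  inject₁-≤⇒≤ : ∀ {i} → toℕ (inject₁ i) ≤ toℕ (inject₁ k) → toℕ i ≤ toℕ k
  inject₁-≤⇒≤ {i} = subst₂ _≤_ (toℕ-inject₁ i) (toℕ-inject₁ k)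
  ≤⇒inject₁-≤ : ∀ {i} → toℕ i ≤ toℕ k → toℕ (inject₁ i) ≤ toℕ (inject₁ k)
  ≤⇒inject₁-≤ {i} = subst₂ _≤_ (sym (toℕ-inject₁ i)) (sym (toℕ-inject₁ k))
  fromℕ≰ : ¬ (toℕ (fromℕ m) ≤ toℕ (inject₁ k))
  fromℕ≰ = <⇒≱ (toℕ<n k) ∘ subst₂ _≤_ (toℕ-fromℕ m) (toℕ-inject₁ k)

atMost-fromℕ : ∀ m → atMost (fromℕ m) ≡ allFin (suc m)
atMost-fromℕ m = filter-all (_≤?ᶠ fromℕ m) (universal ≤fromℕ (allFin (suc m)))

sumVars : ∀ {m} → List (Fin m) → Poly m
sumVars is = sumP (map varP is)

⟦⟧-sumVars-map : ∀ {m n} (σ : Fin m → Fin n) (φ : Monomial m → Monomial n) →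
                 (∀ i → unit (σ i) ≡ φ (unit i)) →
                 ∀ is g → ⟦ sumVars (map σ is) ⟧ g ≡ ⟦ sumVars is ⟧ (g ∘ φ)
⟦⟧-sumVars-map σ φ σ≈φ [] g = refl
⟦⟧-sumVars-map σ φ σ≈φ (i ∷ is) g =
  cong₂ _+_ (cong (λ e → 1 * g e) (σ≈φ i)) (⟦⟧-sumVars-map σ φ σ≈φ is g)

⟦⟧-sumVars-∷ʳ : ∀ {m} (is : List (Fin m)) j g → ⟦ sumVars (is List.∷ʳ j) ⟧ g ≡ ⟦ sumVars is ⟧ g + g (unit j)
⟦⟧-sumVars-∷ʳ [] j g = trans (⟦⟧-singleton (unit j) g) (sym (+-identityˡ _))
⟦⟧-sumVars-∷ʳ (i ∷ is) j g =
  trans (cong (1 * g (unit i) +_) (⟦⟧-sumVars-∷ʳ is j g)) (sym (+-assoc (1 * g (unit i)) _ _))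

⟦⟧-partialSum-zero : ∀ {m} g → ⟦ partialSum {suc m} Fin.zero ⟧ g ≡ g (unit Fin.zero)
⟦⟧-partialSum-zero {m} g =
  trans (cong (λ is → ⟦ sumVars is ⟧ g) (atMost-zero m)) (⟦⟧-singleton (unit Fin.zero) g)

⟦⟧-partialSum-suc : ∀ {m} (k : Fin m) g →
                    ⟦ partialSum (Fin.suc k) ⟧ g ≡ g (unit Fin.zero) + ⟦ partialSum k ⟧ (g ∘ (0 ∷_))
⟦⟧-partialSum-suc k g =
  trans (cong (λ is → ⟦ sumVars is ⟧ g) (atMost-suc k))
        (cong₂ _+_ (*-identityˡ _) (⟦⟧-sumVars-map Fin.suc (0 ∷_) (λ _ → refl) (atMost k) g))

⟦⟧-partialSum-inject₁ : ∀ {m} (k : Fin m) g → ⟦ partialSum (inject₁ k) ⟧ g ≡ ⟦ partialSum k ⟧ (g ∘ (_∷ʳ 0))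
⟦⟧-partialSum-inject₁ k g =
  trans (cong (λ is → ⟦ sumVars is ⟧ g) (atMost-inject₁ k))
        (⟦⟧-sumVars-map inject₁ (_∷ʳ 0) unit-inject₁ (atMost k) g)

⟦⟧-partialSum-fromℕ : ∀ m g → ⟦ partialSum (fromℕ m) ⟧ g
                              ≡ ⟦ sumVars (allFin m) ⟧ (g ∘ (_∷ʳ 0)) + g (unit (fromℕ m))
⟦⟧-partialSum-fromℕ m g = begin
  ⟦ partialSum (fromℕ m) ⟧ g
    ≡⟨ cong (λ is → ⟦ sumVars is ⟧ g) (trans (atMost-fromℕ m) (allFin-∷ʳ m)) ⟩
  ⟦ sumVars (map inject₁ (allFin m) List.∷ʳ fromℕ m) ⟧ g
    ≡⟨ ⟦⟧-sumVars-∷ʳ (map inject₁ (allFin m)) (fromℕ m) g ⟩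
  ⟦ sumVars (map inject₁ (allFin m)) ⟧ g + g (unit (fromℕ m))
    ≡⟨ cong (_+ g (unit (fromℕ m))) (⟦⟧-sumVars-map inject₁ (_∷ʳ 0) unit-inject₁ (allFin m) g) ⟩
  ⟦ sumVars (allFin m) ⟧ (g ∘ (_∷ʳ 0)) + g (unit (fromℕ m)) ∎

p-suc-∷ : ∀ m → p (suc m) ≡ partialSum Fin.zero *P prodP (map (partialSum ∘ Fin.suc) (allFin m))
p-suc-∷ m = cong (λ qs → partialSum Fin.zero *P prodP qs)
                 (trans (map-tabulate Fin.suc partialSum) (sym (map-tabulate id (partialSum ∘ Fin.suc))))

p-suc-∷ʳ : ∀ m → p (suc m) ≡ prodP (map (partialSum ∘ inject₁) (allFin m) List.∷ʳ partialSum (fromℕ m))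
p-suc-∷ʳ m = cong prodP (begin
  map partialSum (allFin (suc m))
    ≡⟨ cong (map partialSum) (allFin-∷ʳ m) ⟩
  map partialSum (map inject₁ (allFin m) List.∷ʳ fromℕ m)
    ≡⟨ map-++ partialSum (map inject₁ (allFin m)) _ ⟩
  map partialSum (map inject₁ (allFin m)) List.∷ʳ partialSum (fromℕ m)
    ≡⟨ cong (List._∷ʳ partialSum (fromℕ m)) (sym (map-∘ (allFin m))) ⟩
  map (partialSum ∘ inject₁) (allFin m) List.∷ʳ partialSum (fromℕ m) ∎)

δ-1∷-unit-zero : ∀ {m} (a : Monomial m) f → δ (1 ∷ a) (unit Fin.zero +ᵐ f) ≡ atHeadZero (δ a) f
δ-1∷-unit-zero a (zero ∷ e) = trans (δ-injective (1 ∷_) ∷-injectiveʳ a (0ᵐ +ᵐ e)) (cong (δ a) (+ᵐ-identityˡ e))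
δ-1∷-unit-zero a (suc x ∷ e) = δ-≢ {a = 1 ∷ a} {e = suc (suc x) ∷ (0ᵐ +ᵐ e)} (λ ())

coeff-p-∷ : ∀ m (a : Monomial m) → coeff (p (suc m)) (1 ∷ a) ≡ coeff (p m) a
coeff-p-∷ m a = begin
  coeff (p (suc m)) (1 ∷ a)
    ≡⟨ coeff≡⟦⟧δ (p (suc m)) (1 ∷ a) ⟩
  ⟦ p (suc m) ⟧ (δ (1 ∷ a))
    ≡⟨ cong (λ q → ⟦ q ⟧ (δ (1 ∷ a))) (p-suc-∷ m) ⟩
  ⟦ partialSum Fin.zero *P R ⟧ (δ (1 ∷ a))
    ≡⟨ ⟦⟧-*P (partialSum Fin.zero) R (δ (1 ∷ a)) ⟩
  ⟦ partialSum Fin.zero ⟧ (λ e → ⟦ R ⟧ (λ f → δ (1 ∷ a) (e +ᵐ f)))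
    ≡⟨ ⟦⟧-partialSum-zero (λ e → ⟦ R ⟧ (λ f → δ (1 ∷ a) (e +ᵐ f))) ⟩
  ⟦ R ⟧ (λ f → δ (1 ∷ a) (unit Fin.zero +ᵐ f))
    ≡⟨ ⟦⟧-cong R (δ-1∷-unit-zero a) ⟩
  ⟦ R ⟧ (atHeadZero (δ a))
    ≡⟨ ⟦⟧-prodP-atHeadZero (partialSum ∘ Fin.suc) partialSum ⟦⟧-partialSum-suc (allFin m) (δ a) ⟩
  ⟦ p m ⟧ (δ a)
    ≡⟨ coeff≡⟦⟧δ (p m) a ⟨
  coeff (p m) a ∎
  where
  R : Poly (suc m)
  R = prodP (map (partialSum ∘ Fin.suc) (allFin m))

⟦⟧-partialSum-fromℕ-δ : ∀ {m} (a e : Monomial m) →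
                        ⟦ partialSum (fromℕ m) ⟧ (λ f → δ (a ∷ʳ 1) ((e ∷ʳ 0) +ᵐ f)) ≡ δ a e
⟦⟧-partialSum-fromℕ-δ {m} a e = begin
  ⟦ partialSum (fromℕ m) ⟧ (λ f → δ (a ∷ʳ 1) ((e ∷ʳ 0) +ᵐ f))
    ≡⟨ ⟦⟧-partialSum-fromℕ m _ ⟩
  ⟦ sumVars (allFin m) ⟧ (λ f → δ (a ∷ʳ 1) ((e ∷ʳ 0) +ᵐ (f ∷ʳ 0))) + δ (a ∷ʳ 1) ((e ∷ʳ 0) +ᵐ unit (fromℕ m))
    ≡⟨ cong₂ _+_ (⟦⟧-vanishing (sumVars (allFin m)) last≡0) (cong (δ (a ∷ʳ 1)) last≡1) ⟩
  0 + δ (a ∷ʳ 1) (e ∷ʳ 1)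
    ≡⟨ δ-injective (_∷ʳ 1) (∷ʳ-injectiveˡ _ _) a e ⟩
  δ a e ∎
  where
  last≡0 : ∀ f → δ (a ∷ʳ 1) ((e ∷ʳ 0) +ᵐ (f ∷ʳ 0)) ≡ 0
  last≡0 f = trans (cong (δ (a ∷ʳ 1)) (+ᵐ-∷ʳ e f 0 0)) (δ-≢ (λ eq → 0≢1+n (∷ʳ-injectiveʳ _ _ eq)))
  last≡1 : (e ∷ʳ 0) +ᵐ unit (fromℕ m) ≡ e ∷ʳ 1
  last≡1 = begin
    (e ∷ʳ 0) +ᵐ unit (fromℕ m) ≡⟨ cong ((e ∷ʳ 0) +ᵐ_) (unit-fromℕ m) ⟩
    (e ∷ʳ 0) +ᵐ (0ᵐ ∷ʳ 1)      ≡⟨ +ᵐ-∷ʳ e 0ᵐ 0 1 ⟩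
    (e +ᵐ 0ᵐ) ∷ʳ 1           ≡⟨ cong (_∷ʳ 1) (+ᵐ-identityʳ e) ⟩
    e ∷ʳ 1                   ∎

coeff-p-∷ʳ : ∀ m (a : Monomial m) → coeff (p (suc m)) (a ∷ʳ 1) ≡ coeff (p m) a
coeff-p-∷ʳ m a = begin
  coeff (p (suc m)) (a ∷ʳ 1)
    ≡⟨ coeff≡⟦⟧δ (p (suc m)) (a ∷ʳ 1) ⟩
  ⟦ p (suc m) ⟧ (δ (a ∷ʳ 1))
    ≡⟨ cong (λ q → ⟦ q ⟧ (δ (a ∷ʳ 1))) (p-suc-∷ʳ m) ⟩
  ⟦ prodP (map (partialSum ∘ inject₁) (allFin m) List.∷ʳ L) ⟧ (δ (a ∷ʳ 1))
    ≡⟨ ⟦⟧-prodP-∷ʳ (map (partialSum ∘ inject₁) (allFin m)) L (δ (a ∷ʳ 1)) ⟩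
  ⟦ prodP (map (partialSum ∘ inject₁) (allFin m)) ⟧ (λ e → ⟦ L ⟧ (λ f → δ (a ∷ʳ 1) (e +ᵐ f)))
    ≡⟨ ⟦⟧-prodP-hom (_∷ʳ 0) (0ᵐ-∷ʳ m) (λ e f → sym (+ᵐ-∷ʳ e f 0 0))
                    (partialSum ∘ inject₁) partialSum ⟦⟧-partialSum-inject₁ (allFin m) _ ⟩
  ⟦ p m ⟧ (λ e → ⟦ L ⟧ (λ f → δ (a ∷ʳ 1) ((e ∷ʳ 0) +ᵐ f)))
    ≡⟨ ⟦⟧-cong (p m) (⟦⟧-partialSum-fromℕ-δ a) ⟩
  ⟦ p m ⟧ (δ a)
    ≡⟨ coeff≡⟦⟧δ (p m) a ⟨
  coeff (p m) a ∎
  where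
  L : Poly (suc m)
  L = partialSum (fromℕ m)

sum-toList : ∀ {m} (a : Vec ℕ m) → sumL (toList a) ≡ Vec.sum a
sum-toList Vec.[] = refl
sum-toList (x ∷ a) = cong (x +_) (sum-toList a)

sum-drop-∷ʳ1 : ∀ {m} (a : Vec ℕ m) {k} → k ≤ m →
               sumL (List.drop k (toList (a ∷ʳ 1))) ≡ suc (sumL (List.drop k (toList a)))
sum-drop-∷ʳ1 Vec.[] {zero} _ = refl
sum-drop-∷ʳ1 (x ∷ a) {zero} _ = trans (cong (x +_) (sum-drop-∷ʳ1 a z≤n)) (+-suc x _)
sum-drop-∷ʳ1 (x ∷ a) {suc k} k≤m = sum-drop-∷ʳ1 a (s≤s⁻¹ k≤m)

InA-tail≤ : ∀ {m} {a : Vec ℕ m} → InA m a → ∀ {k} → 1 ≤ k → k ≤ m →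
            sumL (List.drop k (toList a)) ≤ m ∸ k
InA-tail≤ {m} {a} A {k} 1≤k k≤m with m≤n⇒m<n∨m≡n k≤m
... | inj₁ k<m  = InA.tails A k 1≤k k<m
... | inj₂ refl rewrite drop-all m (toList a) (≤-reflexive (length-toList a)) = z≤n

InA-1∷ : ∀ {m} {a : Vec ℕ m} → InA m a → InA (suc m) (1 ∷ a)
InA-1∷ {m} {a} A = record { tails = tails ; total = cong suc (InA.total A) }
  where
  tails : ∀ k → 1 ≤ k → k < suc m → sumL (List.drop k (toList (1 ∷ a))) ≤ suc m ∸ k
  tails 1             _ _   = ≤-reflexive (trans (sum-toList a) (InA.total A))
  tails (suc (suc k)) _ k<m = InA.tails A (suc k) (s≤s z≤n) (s≤s⁻¹ k<m)

InA-∷ʳ1 : ∀ {m} {a : Vec ℕ m} → InA m a → InA (suc m) (a ∷ʳ 1)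
InA-∷ʳ1 {m} {a} A = record { tails = tails ; total = total }
  where
  tails : ∀ k → 1 ≤ k → k < suc m → sumL (List.drop k (toList (a ∷ʳ 1))) ≤ suc m ∸ k
  tails k 1≤k k<1+m = subst₂ _≤_ (sym (sum-drop-∷ʳ1 a k≤m)) (sym (+-∸-assoc 1 k≤m))
                                (s≤s (InA-tail≤ A 1≤k k≤m))
    where
    k≤m : k ≤ m
    k≤m = s≤s⁻¹ k<1+m
  total : Vec.sum (a ∷ʳ 1) ≡ suc m
  total = begin
    Vec.sum (a ∷ʳ 1)        ≡⟨ sum-toList (a ∷ʳ 1) ⟨
    sumL (toList (a ∷ʳ 1))  ≡⟨ sum-drop-∷ʳ1 a z≤n ⟩
    suc (sumL (toList a))   ≡⟨ cong suc (trans (sum-toList a) (InA.total A)) ⟩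
    suc m                   ∎

lemma3 : (m : ℕ) → 1 ≤ m → (a : Vec ℕ m) → InA m a →
         InA (suc m) (1 ∷ a) × InA (suc m) (a ∷ʳ 1)
         × coeff (p (suc m)) (1 ∷ a) ≡ coeff (p m) a
         × coeff (p (suc m)) (a ∷ʳ 1) ≡ coeff (p m) a
lemma3 m _ a A = InA-1∷ A , InA-∷ʳ1 A , coeff-p-∷ m a , coeff-p-∷ʳ m a
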